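{- If $\varphi$ is a modal formula (resp. a black modal formula or a bimodal formula), $\underline{B}$ a subordination algebra and $\underline{A}$ a subalgebra (resp. a black subalgebra or a strong subalgebra) of $\underline{B}$, then \[ \underline{B}\models\varphi\ \Rightarrow\ \underline{A}\models\varphi. \]
   Context: Subordination algebra: $(B,\prec)$, $B$ Boolean, each $\prec(b,-)$ a filter and each $\prec(-,b)$ an ideal. A subalgebra of $\underline{B}$ is a Boolean subalgebra $A$ (with the restricted relation) such that $a\in A$, $b\in B$, $a\prec b$ imply $a\prec c\leq b$ for some $c\in A$ (equivalently, the inclusion is a Boolean homomorphism preserving $\prec$ and satisfying: $f(a)\prec c$ implies $a\prec b$ and $f(b)\leq c$ for some $b$). A black subalgebra is a Boolean subalgebra $A$ such that $a\in A$, $b\in B$, $b\prec a$ imply $b\leq c\prec a$ for some $c\in A$ (the inclusion satisfies: $c\prec f(a)$ implies $b\prec a$ and $c\leq f(b)$ for some $b$). A strong subalgebra is both. Modal (white) formulas use $\lozenge$ and $\square$ only, black modal formulas use only the black diamond (written here $\lozenge^{ - }$) and its dual $\square^{ - }$, bimodal formulas use both. Formulas are evaluated, for valuations into $B$, in the canonical extension $\mathcal{P}(\mathrm{Ult}(B))$ with $\lozenge E=R(-,E)$, $\lozenge^{ - }E=R(E,-)$, where $x\mathrel{R}y$ iff $\prec(y,-)\subseteq x$; $\underline{B}\models\varphi$ means $\varphi$ evaluates to the top under all valuations. -}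

module Defs where

open import Level using (0ℓ) renaming (suc to lsuc)
open import Data.Nat using (ℕ)
open import Data.Product using (Σ; _×_; _,_)
open import Data.Sum using (_⊎_)
open import Data.Empty renaming (⊥ to Empty)
open import Relation.Nullary renaming (¬_ to Not)
open import Axiom.ExcludedMiddle using (ExcludedMiddle)
open import Algebra.Lattice.Bundles using (BooleanAlgebra)

module BA (B : BooleanAlgebra 0ℓ 0ℓ) where
  open BooleanAlgebra B public

  _≤_ : Carrier → Carrier → Set
  a ≤ b = (a ∧ b) ≈ a

  record IsFilter (F : Carrier → Set) : Set where
    field
      top   : F ⊤
      up    : ∀ {a b} → F a → a ≤ b → F b
      meet  : ∀ {a b} → F a → F b → F (a ∧ b)

  record IsIdeal (I : Carrier → Set) : Set where
    field
      bot   : I ⊥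
      down  : ∀ {a b} → a ≤ b → I b → I a
      join  : ∀ {a b} → I a → I b → I (a ∨ b)

  record IsUltrafilter (U : Carrier → Set) : Set where
    field
      filter : IsFilter U
      proper : Not (U ⊥)
      prime  : ∀ a → U a ⊎ U (¬ a)

  record Ult : Set₁ where
    field
      mem  : Carrier → Set
      isUF : IsUltrafilter mem

  open Ult public

-- Ultrafilter lemma (a consequence of ZFC used in the paper's setting):
-- every proper filter of a Boolean algebra extends to an ultrafilter.
UltrafilterLemma : Set₁
UltrafilterLemma = (B : BooleanAlgebra 0ℓ 0ℓ) → let open BA B in
  (F : Carrier → Set) → IsFilter F → Not (F ⊥) →
  Σ (Ult) λ U → ∀ a → F a → mem U a

record SubordinationAlgebra : Set₁ where
  field
    B   : BooleanAlgebra 0ℓ 0ℓ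
  open BA B
  field
    _≺_ : Carrier → Carrier → Set
    ≺-filter : ∀ b → IsFilter (λ c → b ≺ c)
    ≺-ideal  : ∀ b → IsIdeal (λ a → a ≺ b)

module SA (S : SubordinationAlgebra) where
  open SubordinationAlgebra S public using (B; _≺_)
  open BA B public

  -- ≺[y] = ≺(y,-) = { b | a ≺ b for some a ∈ y }
  -- x R y  iff  ≺(y,-) ⊆ x
  R : Ult → Ult → Set
  R x y = ∀ b → Σ Carrier (λ a → mem y a × (a ≺ b)) → mem x b

data Fm : Set where
  var        : ℕ → Fm
  ⊤ᶠ ⊥ᶠ      : Fm
  ¬ᶠ_        : Fm → Fm
  _∧ᶠ_ _∨ᶠ_ _⇒ᶠ_ : Fm → Fm → Fm
  ◇ □        : Fm → Fm
  ◇⁻ □⁻      : Fm → Fm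

data White : Fm → Set where
  var : ∀ n → White (var n)
  ⊤ᶠ  : White ⊤ᶠ
  ⊥ᶠ  : White ⊥ᶠ
  ¬ᶠ_ : ∀ {φ} → White φ → White (¬ᶠ φ)
  _∧ᶠ_ : ∀ {φ ψ} → White φ → White ψ → White (φ ∧ᶠ ψ)
  _∨ᶠ_ : ∀ {φ ψ} → White φ → White ψ → White (φ ∨ᶠ ψ)
  _⇒ᶠ_ : ∀ {φ ψ} → White φ → White ψ → White (φ ⇒ᶠ ψ)
  ◇   : ∀ {φ} → White φ → White (◇ φ)
  □   : ∀ {φ} → White φ → White (□ φ)

data Black : Fm → Set where
  var : ∀ n → Black (var n)
  ⊤ᶠ  : Black ⊤ᶠ
  ⊥ᶠ  : Black ⊥ᶠ
  ¬ᶠ_ : ∀ {φ} → Black φ → Black (¬ᶠ φ)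
  _∧ᶠ_ : ∀ {φ ψ} → Black φ → Black ψ → Black (φ ∧ᶠ ψ)
  _∨ᶠ_ : ∀ {φ ψ} → Black φ → Black ψ → Black (φ ∨ᶠ ψ)
  _⇒ᶠ_ : ∀ {φ ψ} → Black φ → Black ψ → Black (φ ⇒ᶠ ψ)
  ◇⁻  : ∀ {φ} → Black φ → Black (◇⁻ φ)
  □⁻  : ∀ {φ} → Black φ → Black (□⁻ φ)

-- (bimodal formulas: all of Fm)

-- Semantics in the canonical extension P(Ult B)

module Sem (S : SubordinationAlgebra) where
  open SA S

  Sub : Set₂
  Sub = Ult → Set₁

  ⟦_⟧ : Fm → (ℕ → Carrier) → Sub
  ⟦ var n ⟧ v x = Level.Lift _ (mem x (v n))
  ⟦ ⊤ᶠ ⟧ v x = Level.Lift _ Data.Unit.⊤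
    where import Data.Unit
  ⟦ ⊥ᶠ ⟧ v x = Level.Lift _ Empty
  ⟦ ¬ᶠ φ ⟧ v x = Not (⟦ φ ⟧ v x)
  ⟦ φ ∧ᶠ ψ ⟧ v x = ⟦ φ ⟧ v x × ⟦ ψ ⟧ v x
  ⟦ φ ∨ᶠ ψ ⟧ v x = ⟦ φ ⟧ v x ⊎ ⟦ ψ ⟧ v x
  ⟦ φ ⇒ᶠ ψ ⟧ v x = ⟦ φ ⟧ v x → ⟦ ψ ⟧ v x
  ⟦ ◇ φ ⟧ v x = Σ Ult λ y → R x y × ⟦ φ ⟧ v y
  ⟦ □ φ ⟧ v x = Not (Σ Ult λ y → R x y × Not (⟦ φ ⟧ v y))
  ⟦ ◇⁻ φ ⟧ v y = Σ Ult λ x → R x y × ⟦ φ ⟧ v x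
  ⟦ □⁻ φ ⟧ v y = Not (Σ Ult λ x → R x y × Not (⟦ φ ⟧ v x))

  _⊨_ : Fm → Set₁
  _⊨_ φ = ∀ (v : ℕ → Carrier) (x : Ult) → ⟦ φ ⟧ v x

_⊨_ : SubordinationAlgebra → Fm → Set₁
S ⊨ φ = Sem._⊨_ S φ

-- Subalgebras, presented via the inclusion map f : A → B
-- (an injective Boolean homomorphism, A carrying the restricted relation)

record IsEmbedding (A S : SubordinationAlgebra) : Set₁ where
  module A = SA A
  module B = SA S
  field
    f      : A.Carrier → B.Carrier
    cong   : ∀ {a b} → a A.≈ b → f a B.≈ f b
    inj    : ∀ {a b} → f a B.≈ f b → a A.≈ b
    hom-∧  : ∀ a b → f (a A.∧ b) B.≈ (f a B.∧ f b)
    hom-∨  : ∀ a b → f (a A.∨ b) B.≈ (f a B.∨ f b)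
    hom-¬  : ∀ a → f (A.¬ a) B.≈ (B.¬ f a)
    hom-⊤  : f A.⊤ B.≈ B.⊤
    hom-⊥  : f A.⊥ B.≈ B.⊥
    restrict : ∀ a b → (a A.≺ b → f a B.≺ f b) × (f a B.≺ f b → a A.≺ b)

record IsSubalgebra (A S : SubordinationAlgebra) : Set₁ where
  field emb : IsEmbedding A S
  open IsEmbedding emb
  field
    white : ∀ (a : A.Carrier) (b : B.Carrier) → f a B.≺ b →
            Σ A.Carrier λ c → (a A.≺ c) × (f c B.≤ b)

record IsBlackSubalgebra (A S : SubordinationAlgebra) : Set₁ where
  field emb : IsEmbedding A S
  open IsEmbedding emb
  field
    black : ∀ (a : A.Carrier) (b : B.Carrier) → b B.≺ f a →
            Σ A.Carrier λ c → (b B.≤ f c) × (c A.≺ a)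

record IsStrongSubalgebra (A S : SubordinationAlgebra) : Set₁ where
  field emb : IsEmbedding A S
  open IsEmbedding emb
  field
    white : ∀ (a : A.Carrier) (b : B.Carrier) → f a B.≺ b →
            Σ A.Carrier λ c → (a A.≺ c) × (f c B.≤ b)
    black : ∀ (a : A.Carrier) (b : B.Carrier) → b B.≺ f a →
            Σ A.Carrier λ c → (b B.≤ f c) × (c A.≺ a)

-- Let f : A → B be the inclusion. Every ultrafilter y of B restricts to the
-- ultrafilter f⁻¹(y) of A, and by the ultrafilter lemma every ultrafilter of A
-- arises this way. The map y ↦ f⁻¹(y) always reflects the relation R; the
-- white (black) subalgebra condition is exactly what is needed to lift an
-- R-successor (R-predecessor) of f⁻¹(y) to one of y, by showing that a suitable
-- filter is proper. Hence "x = f⁻¹(y)" is a bisimulation for the modalities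
-- available in the fragment, so φ holds at f⁻¹(y) under v iff it holds at y
-- under f ∘ v, and validity in B transfers to A.
module Submission where

open import Defs
open import Level using (0ℓ; lift; lower)
open import Data.Product using (Σ; _×_; _,_; proj₁)
open import Data.Sum using (inj₁; inj₂; map₂)
open import Data.Empty using (⊥-elim) renaming (⊥ to Empty)
open import Function using (_∘_; flip)
open import Function.Bundles using (_⇔_; mk⇔; Equivalence)
open import Function.Construct.Identity using (⇔-id)
open import Function.Related.TypeIsomorphisms using (¬-cong-⇔; →-cong-⇔)
open import Data.Product.Function.NonDependent.Propositional using (_×-⇔_)
open import Data.Sum.Function.Propositional using (_⊎-⇔_)
open import Relation.Nullary.Negation.Core using () renaming (¬_ to Not)
open import Axiom.ExcludedMiddle using (ExcludedMiddle)
open import Algebra.Lattice.Bundles using (BooleanAlgebra)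
import Algebra.Lattice.Properties.BooleanAlgebra as BooleanAlgebraProperties
import Algebra.Lattice.Properties.Lattice as LatticeProperties
import Relation.Binary.Lattice.Bundles as OrderTheoretic
import Relation.Binary.Reasoning.Setoid as SetoidReasoning

module BooleanOrder (𝔹 : BooleanAlgebra 0ℓ 0ℓ) where
  open BA 𝔹
  open BooleanAlgebraProperties 𝔹
    using (∧-identityʳ; ∧-zeroˡ; ∧-zeroʳ; ¬⊥≈⊤; ¬⊤≈⊥; ¬-involutive; deMorgan₁; deMorgan₂)
  -- The library's order is x ≈ x ∧ y, the symmetric form of _≤_.
  private module O = OrderTheoretic.Lattice (LatticeProperties.∨-∧-orderTheoreticLattice lattice)

  ≤-reflexive : ∀ {a b} → a ≈ b → a ≤ b
  ≤-reflexive a≈b = sym (O.reflexive a≈b)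

  ≤-refl : ∀ {a} → a ≤ a
  ≤-refl = ≤-reflexive refl

  ≤-trans : ∀ {a b c} → a ≤ b → b ≤ c → a ≤ c
  ≤-trans a≤b b≤c = sym (O.trans (sym a≤b) (sym b≤c))

  x∧y≤x : ∀ x y → (x ∧ y) ≤ x
  x∧y≤x x y = sym (O.x∧y≤x x y)

  x∧y≤y : ∀ x y → (x ∧ y) ≤ y
  x∧y≤y x y = sym (O.x∧y≤y x y)

  ∧-greatest : ∀ {a b c} → a ≤ b → a ≤ c → a ≤ (b ∧ c)
  ∧-greatest a≤b a≤c = sym (O.∧-greatest (sym a≤b) (sym a≤c))

  x≤x∨y : ∀ x y → x ≤ (x ∨ y)
  x≤x∨y x y = sym (O.x≤x∨y x y)

  y≤x∨y : ∀ x y → y ≤ (x ∨ y)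
  y≤x∨y x y = sym (O.y≤x∨y x y)

  ∨-least : ∀ {a b c} → a ≤ c → b ≤ c → (a ∨ b) ≤ c
  ∨-least a≤c b≤c = sym (O.∨-least (sym a≤c) (sym b≤c))

  ∧-monotonic : ∀ {a b c d} → a ≤ c → b ≤ d → (a ∧ b) ≤ (c ∧ d)
  ∧-monotonic {a} {b} a≤c b≤d =
    ∧-greatest (≤-trans (x∧y≤x a b) a≤c) (≤-trans (x∧y≤y a b) b≤d)

  x≤⊤ : ∀ x → x ≤ ⊤
  x≤⊤ = ∧-identityʳ

  ⊥≤x : ∀ x → ⊥ ≤ x
  ⊥≤x = ∧-zeroˡ

  x≤⊥⇒x≈⊥ : ∀ {a} → a ≤ ⊥ → a ≈ ⊥
  x≤⊥⇒x≈⊥ {a} a≤⊥ = trans (sym a≤⊥) (∧-zeroʳ a)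

  ¬-antitone : ∀ {a b} → a ≤ b → (¬ b) ≤ (¬ a)
  ¬-antitone {a} {b} a≤b = begin
    ¬ b ∧ ¬ a       ≈⟨ sym (deMorgan₂ b a) ⟩
    ¬ (b ∨ a)       ≈⟨ ¬-cong (∨-congˡ (sym a≤b)) ⟩
    ¬ (b ∨ (a ∧ b)) ≈⟨ ¬-cong (∨-congˡ (∧-comm a b)) ⟩
    ¬ (b ∨ (b ∧ a)) ≈⟨ ¬-cong (∨-absorbs-∧ b a) ⟩
    ¬ b             ∎
    where open SetoidReasoning setoid

  x∧¬y≤⊥⇒x≤y : ∀ {a b} → (a ∧ ¬ b) ≤ ⊥ → a ≤ b
  x∧¬y≤⊥⇒x≤y {a} {b} a∧¬b≤⊥ =
    ≤-trans (∧-greatest ≤-refl (≤-trans (x≤⊤ a) (≤-reflexive (sym (∨-complementʳ b)))))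
   (≤-trans (≤-reflexive (∧-distribˡ-∨ a b (¬ b)))
            (∨-least (x∧y≤y a b) (≤-trans a∧¬b≤⊥ (⊥≤x b))))

  x∧y≤⊥⇒x≤¬y : ∀ {a b} → (a ∧ b) ≤ ⊥ → a ≤ (¬ b)
  x∧y≤⊥⇒x≤¬y {a} {b} a∧b≤⊥ =
    x∧¬y≤⊥⇒x≤y (≤-trans (∧-monotonic ≤-refl (≤-reflexive (¬-involutive b))) a∧b≤⊥)

  Pred : Set₁
  Pred = Carrier → Set

  filter-resp : ∀ {F} → IsFilter F → ∀ {a b} → F a → a ≈ b → F b
  filter-resp isF Fa a≈b = IsFilter.up isF Fa (≤-reflexive a≈b)

  ideal-resp : ∀ {I} → IsIdeal I → ∀ {a b} → I a → a ≈ b → I b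
  ideal-resp isI Ia a≈b = IsIdeal.down isI (≤-reflexive (sym a≈b)) Ia

  _⊔_ : Pred → Pred → Pred
  (F ⊔ G) c = Σ Carrier λ a → Σ Carrier λ b → F a × G b × (a ∧ b) ≤ c

  ⊔-isFilter : ∀ {F G} → IsFilter F → IsFilter G → IsFilter (F ⊔ G)
  ⊔-isFilter isF isG = record
    { top  = ⊤ , ⊤ , F.top , G.top , x≤⊤ (⊤ ∧ ⊤)
    ; up   = λ { (a , b , Fa , Gb , a∧b≤c) c≤d → a , b , Fa , Gb , ≤-trans a∧b≤c c≤d }
    ; meet = λ { (a₁ , b₁ , Fa₁ , Gb₁ , l₁) (a₂ , b₂ , Fa₂ , Gb₂ , l₂) →
        (a₁ ∧ a₂) , (b₁ ∧ b₂) , F.meet Fa₁ Fa₂ , G.meet Gb₁ Gb₂ ,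
        ∧-greatest (≤-trans (∧-monotonic (x∧y≤x a₁ a₂) (x∧y≤x b₁ b₂)) l₁)
                   (≤-trans (∧-monotonic (x∧y≤y a₁ a₂) (x∧y≤y b₁ b₂)) l₂) }
    }
    where
    module F = IsFilter isF
    module G = IsFilter isG

  ⊔-inj₁ : ∀ {F G} → IsFilter G → ∀ {a} → F a → (F ⊔ G) a
  ⊔-inj₁ isG {a} Fa = a , ⊤ , Fa , IsFilter.top isG , x∧y≤x a ⊤

  ⊔-inj₂ : ∀ {F G} → IsFilter F → ∀ {b} → G b → (F ⊔ G) b
  ⊔-inj₂ isF {b} Gb = ⊤ , b , IsFilter.top isF , Gb , x∧y≤y ⊤ b

  ∁ : Pred → Pred
  ∁ P c = P (¬ c)

  ∁-isIdeal : ∀ {F} → IsFilter F → IsIdeal (∁ F)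
  ∁-isIdeal isF = record
    { bot  = filter-resp isF F.top (sym ¬⊥≈⊤)
    ; down = λ a≤b F¬b → F.up F¬b (¬-antitone a≤b)
    ; join = λ {a} {b} F¬a F¬b → filter-resp isF (F.meet F¬a F¬b) (sym (deMorgan₂ a b))
    }
    where module F = IsFilter isF

  ∁-isFilter : ∀ {I} → IsIdeal I → IsFilter (∁ I)
  ∁-isFilter isI = record
    { top  = ideal-resp isI I.bot (sym ¬⊤≈⊥)
    ; up   = λ I¬a a≤b → I.down (¬-antitone a≤b) I¬a
    ; meet = λ {a} {b} I¬a I¬b → ideal-resp isI (I.join I¬a I¬b) (sym (deMorgan₁ a b))
    }
    where module I = IsIdeal isI

  Ult-isFilter : ∀ u → IsFilter (mem u)
  Ult-isFilter u = IsUltrafilter.filter (isUF u)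

  Ult-consistent : ∀ u {a} → mem u a → mem u (¬ a) → Empty
  Ult-consistent u ua u¬a =
    IsUltrafilter.proper (isUF u)
      (IsFilter.up (Ult-isFilter u) (IsFilter.meet (Ult-isFilter u) ua u¬a)
                   (≤-reflexive (∧-complementʳ _)))

module Subordination (S : SubordinationAlgebra) where
  open SA S
  open BooleanOrder B
  open SubordinationAlgebra S using (≺-filter; ≺-ideal)

  ≺[_] : Pred → Pred
  ≺[ F ] c = Σ Carrier λ a → F a × a ≺ c

  ≺⁻¹[_] : Pred → Pred
  ≺⁻¹[ I ] c = Σ Carrier λ b → I b × c ≺ b

  ≺[]-isFilter : ∀ {F} → IsFilter F → IsFilter ≺[ F ]
  ≺[]-isFilter isF = record
    { top  = ⊤ , F.top , IsFilter.top (≺-filter ⊤)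
    ; up   = λ { (a , Fa , a≺b) b≤c → a , Fa , IsFilter.up (≺-filter a) a≺b b≤c }
    ; meet = λ { {c₁} {c₂} (a₁ , Fa₁ , a₁≺c₁) (a₂ , Fa₂ , a₂≺c₂) →
        (a₁ ∧ a₂) , F.meet Fa₁ Fa₂ ,
        IsFilter.meet (≺-filter (a₁ ∧ a₂))
          (IsIdeal.down (≺-ideal c₁) (x∧y≤x a₁ a₂) a₁≺c₁)
          (IsIdeal.down (≺-ideal c₂) (x∧y≤y a₁ a₂) a₂≺c₂) }
    }
    where module F = IsFilter isF

  ≺⁻¹[]-isIdeal : ∀ {I} → IsIdeal I → IsIdeal ≺⁻¹[ I ]
  ≺⁻¹[]-isIdeal isI = record
    { bot  = ⊥ , I.bot , IsIdeal.bot (≺-ideal ⊥)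
    ; down = λ { a≤b (c , Ic , b≺c) → c , Ic , IsIdeal.down (≺-ideal c) a≤b b≺c }
    ; join = λ { {a₁} {a₂} (b₁ , Ib₁ , a₁≺b₁) (b₂ , Ib₂ , a₂≺b₂) →
        (b₁ ∨ b₂) , I.join Ib₁ Ib₂ ,
        IsIdeal.join (≺-ideal (b₁ ∨ b₂))
          (IsFilter.up (≺-filter a₁) a₁≺b₁ (x≤x∨y b₁ b₂))
          (IsFilter.up (≺-filter a₂) a₂≺b₂ (y≤x∨y b₁ b₂)) }
    }
    where module I = IsIdeal isI

data Licensed (W K : Set) : Fm → Set where
  var  : ∀ n → Licensed W K (var n)
  ⊤ᶠ   : Licensed W K ⊤ᶠ
  ⊥ᶠ   : Licensed W K ⊥ᶠ
  ¬ᶠ_  : ∀ {φ} → Licensed W K φ → Licensed W K (¬ᶠ φ)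
  _∧ᶠ_ : ∀ {φ ψ} → Licensed W K φ → Licensed W K ψ → Licensed W K (φ ∧ᶠ ψ)
  _∨ᶠ_ : ∀ {φ ψ} → Licensed W K φ → Licensed W K ψ → Licensed W K (φ ∨ᶠ ψ)
  _⇒ᶠ_ : ∀ {φ ψ} → Licensed W K φ → Licensed W K ψ → Licensed W K (φ ⇒ᶠ ψ)
  ◇    : ∀ {φ} → W → Licensed W K φ → Licensed W K (◇ φ)
  □    : ∀ {φ} → W → Licensed W K φ → Licensed W K (□ φ)
  ◇⁻   : ∀ {φ} → K → Licensed W K φ → Licensed W K (◇⁻ φ)
  □⁻   : ∀ {φ} → K → Licensed W K φ → Licensed W K (□⁻ φ)

white-licensed : ∀ {W K φ} → W → White φ → Licensed W K φ
white-licensed w (var n)  = var n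
white-licensed w ⊤ᶠ       = ⊤ᶠ
white-licensed w ⊥ᶠ       = ⊥ᶠ
white-licensed w (¬ᶠ φ)   = ¬ᶠ white-licensed w φ
white-licensed w (φ ∧ᶠ ψ) = white-licensed w φ ∧ᶠ white-licensed w ψ
white-licensed w (φ ∨ᶠ ψ) = white-licensed w φ ∨ᶠ white-licensed w ψ
white-licensed w (φ ⇒ᶠ ψ) = white-licensed w φ ⇒ᶠ white-licensed w ψ
white-licensed w (◇ φ)    = ◇ w (white-licensed w φ)
white-licensed w (□ φ)    = □ w (white-licensed w φ)

black-licensed : ∀ {W K φ} → K → Black φ → Licensed W K φ
black-licensed k (var n)  = var n
black-licensed k ⊤ᶠ       = ⊤ᶠ
black-licensed k ⊥ᶠ       = ⊥ᶠ
black-licensed k (¬ᶠ φ)   = ¬ᶠ black-licensed k φ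
black-licensed k (φ ∧ᶠ ψ) = black-licensed k φ ∧ᶠ black-licensed k ψ
black-licensed k (φ ∨ᶠ ψ) = black-licensed k φ ∨ᶠ black-licensed k ψ
black-licensed k (φ ⇒ᶠ ψ) = black-licensed k φ ⇒ᶠ black-licensed k ψ
black-licensed k (◇⁻ φ)   = ◇⁻ k (black-licensed k φ)
black-licensed k (□⁻ φ)   = □⁻ k (black-licensed k φ)

all-licensed : ∀ {W K} → W → K → ∀ φ → Licensed W K φ
all-licensed w k (var n)  = var n
all-licensed w k ⊤ᶠ       = ⊤ᶠ
all-licensed w k ⊥ᶠ       = ⊥ᶠ
all-licensed w k (¬ᶠ φ)   = ¬ᶠ all-licensed w k φ
all-licensed w k (φ ∧ᶠ ψ) = all-licensed w k φ ∧ᶠ all-licensed w k ψ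
all-licensed w k (φ ∨ᶠ ψ) = all-licensed w k φ ∨ᶠ all-licensed w k ψ
all-licensed w k (φ ⇒ᶠ ψ) = all-licensed w k φ ⇒ᶠ all-licensed w k ψ
all-licensed w k (◇ φ)    = ◇ w (all-licensed w k φ)
all-licensed w k (□ φ)    = □ w (all-licensed w k φ)
all-licensed w k (◇⁻ φ)   = ◇⁻ k (all-licensed w k φ)
all-licensed w k (□⁻ φ)   = □⁻ k (all-licensed w k φ)

module Embedding (ultrafilterLemma : UltrafilterLemma)
                 (A S : SubordinationAlgebra) (e : IsEmbedding A S) where
  module A = SA A
  module B = SA S
  module OA = BooleanOrder A.B
  module OB = BooleanOrder B.B
  open Subordination S
  open OB using (Pred; _⊔_; ∁)
  open IsEmbedding e using (f; cong; inj; hom-∧; hom-¬; hom-⊤; hom-⊥; restrict)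
  open SubordinationAlgebra S using (≺-filter; ≺-ideal)
  open BooleanAlgebraProperties B.B using (¬-involutive)
  module SemA = Sem A
  module SemB = Sem S

  WhiteCondition : Set
  WhiteCondition = ∀ (a : A.Carrier) (b : B.Carrier) → f a B.≺ b →
    Σ A.Carrier λ c → (a A.≺ c) × (f c B.≤ b)

  BlackCondition : Set
  BlackCondition = ∀ (a : A.Carrier) (b : B.Carrier) → b B.≺ f a →
    Σ A.Carrier λ c → (b B.≤ f c) × (c A.≺ a)

  f-monotonic : ∀ {a b} → a A.≤ b → f a B.≤ f b
  f-monotonic {a} {b} a≤b = B.trans (B.sym (hom-∧ a b)) (cong a≤b)

  record IsPreimage (x : A.Ult) (y : B.Ult) : Set where
    constructor isPreimage
    field mem⇔ : ∀ a → A.mem x a ⇔ B.mem y (f a)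
  open IsPreimage

  preimage : B.Ult → A.Ult
  preimage y = record
    { mem  = B.mem y ∘ f
    ; isUF = record
      { filter = record
        { top  = OB.filter-resp y-filter (B.IsFilter.top y-filter) (B.sym hom-⊤)
        ; up   = λ y∋fa a≤b → B.IsFilter.up y-filter y∋fa (f-monotonic a≤b)
        ; meet = λ {a} {b} y∋fa y∋fb →
            OB.filter-resp y-filter (B.IsFilter.meet y-filter y∋fa y∋fb) (B.sym (hom-∧ a b))
        }
      ; proper = λ y∋f⊥ → B.IsUltrafilter.proper (B.isUF y) (OB.filter-resp y-filter y∋f⊥ hom-⊥)
      ; prime  = λ a → map₂ (λ y∋¬fa → OB.filter-resp y-filter y∋¬fa (B.sym (hom-¬ a)))
                            (B.IsUltrafilter.prime (B.isUF y) (f a))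
      }
    }
    where
    y-filter : B.IsFilter (B.mem y)
    y-filter = OB.Ult-isFilter y

  preimage-isPreimage : ∀ y → IsPreimage (preimage y) y
  preimage-isPreimage y = isPreimage λ a → ⇔-id _

  -- The converse inclusion comes for free: x is prime and y is proper.
  ⊆-isPreimage : ∀ {x y} → (∀ a → A.mem x a → B.mem y (f a)) → IsPreimage x y
  ⊆-isPreimage {x} {y} x⊆y = isPreimage λ a → mk⇔ (x⊆y a) (from a)
    where
    from : ∀ a → B.mem y (f a) → A.mem x a
    from a y∋fa with A.IsUltrafilter.prime (A.isUF x) a
    ... | inj₁ x∋a  = x∋a
    ... | inj₂ x∋¬a = ⊥-elim (OB.Ult-consistent y y∋fa
      (OB.filter-resp (OB.Ult-isFilter y) (x⊆y (A.¬ a) x∋¬a) (hom-¬ a)))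

  R-reflect : ∀ {x y x' y'} → IsPreimage x y → IsPreimage x' y' → B.R y y' → A.R x x'
  R-reflect x≡y x'≡y' yRy' b (a , x'∋a , a≺b) =
    Equivalence.from (mem⇔ x≡y b)
      (yRy' (f b) (f a , Equivalence.to (mem⇔ x'≡y' a) x'∋a , proj₁ (restrict a b) a≺b))

  image↑ : A.Ult → Pred
  image↑ x c = Σ A.Carrier λ a → A.mem x a × f a B.≤ c

  image↑-isFilter : ∀ x → B.IsFilter (image↑ x)
  image↑-isFilter x = record
    { top  = A.⊤ , X.top , OB.x≤⊤ (f A.⊤)
    ; up   = λ { (a , x∋a , fa≤b) b≤c → a , x∋a , OB.≤-trans fa≤b b≤c }
    ; meet = λ { (a₁ , x∋a₁ , l₁) (a₂ , x∋a₂ , l₂) →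
        (a₁ A.∧ a₂) , X.meet x∋a₁ x∋a₂ ,
        OB.≤-trans (OB.≤-reflexive (hom-∧ a₁ a₂)) (OB.∧-monotonic l₁ l₂) }
    }
    where module X = A.IsFilter (OA.Ult-isFilter x)

  extend : ∀ x {F} → B.IsFilter F → Not (F B.⊥) → (∀ {c} → image↑ x c → F c) →
    Σ B.Ult λ y → (∀ c → F c → B.mem y c) × IsPreimage x y
  extend x isF F-proper image⊆F with ultrafilterLemma B.B _ isF F-proper
  ... | y , F⊆y = y , F⊆y , ⊆-isPreimage (λ a x∋a → F⊆y (f a) (image⊆F (a , x∋a , OB.≤-refl)))

  image↑-proper : ∀ x → Not (image↑ x B.⊥)
  image↑-proper x (a , x∋a , fa≤⊥) = A.IsUltrafilter.proper (A.isUF x)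
    (OA.filter-resp (OA.Ult-isFilter x) x∋a (inj (B.trans (OB.x≤⊥⇒x≈⊥ fa≤⊥) (B.sym hom-⊥))))

  preimage-surjective : ∀ x → Σ B.Ult (IsPreimage x)
  preimage-surjective x with extend x (image↑-isFilter x) (image↑-proper x) (λ p → p)
  ... | y , _ , x≡y = y , x≡y

  -- A successor y' of y must avoid the ideal of elements subordinate to something
  -- outside y; the white condition makes f[x'] avoid that ideal as well.
  module WhiteLift (white : WhiteCondition)
                   {x y x'} (x≡y : IsPreimage x y) (xRx' : A.R x x') where
    J : Pred
    J = ≺⁻¹[ ∁ (B.mem y) ]

    J-isIdeal : B.IsIdeal J
    J-isIdeal = ≺⁻¹[]-isIdeal (OB.∁-isIdeal (OB.Ult-isFilter y))

    ∁J-isFilter : B.IsFilter (∁ J)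
    ∁J-isFilter = OB.∁-isFilter J-isIdeal

    F-proper : Not ((image↑ x' ⊔ ∁ J) B.⊥)
    F-proper (d , c , (a , x'∋a , fa≤d) , (b , y∋¬b , ¬c≺b) , d∧c≤⊥)
      with white a b (B.IsIdeal.down (≺-ideal b) (OB.≤-trans fa≤d (OB.x∧y≤⊥⇒x≤¬y d∧c≤⊥)) ¬c≺b)
    ... | c' , a≺c' , fc'≤b = OB.Ult-consistent y y∋b y∋¬b
      where
      y∋b : B.mem y b
      y∋b = B.IsFilter.up (OB.Ult-isFilter y)
              (Equivalence.to (mem⇔ x≡y c') (xRx' c' (a , x'∋a , a≺c'))) fc'≤b

    successor : Σ B.Ult λ y' → B.R y y' × IsPreimage x' y'
    successor with extend x' (OB.⊔-isFilter (image↑-isFilter x') ∁J-isFilter) F-proper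
                        (OB.⊔-inj₁ ∁J-isFilter)
    ... | y' , F⊆y' , x'≡y' = y' , yRy' , x'≡y'
      where
      yRy' : B.R y y'
      yRy' b (a , y'∋a , a≺b) with B.IsUltrafilter.prime (B.isUF y) b
      ... | inj₁ y∋b  = y∋b
      ... | inj₂ y∋¬b = ⊥-elim (OB.Ult-consistent y' y'∋a (F⊆y' (B.¬ a)
        (OB.⊔-inj₂ (image↑-isFilter x')
          (OB.ideal-resp J-isIdeal (b , y∋¬b , a≺b) (B.sym (¬-involutive a))))))

  -- A predecessor y' of y must contain ≺[y]; the black condition makes this
  -- compatible with containing f[x'].
  module BlackLift (black : BlackCondition)
                   {x y x'} (x≡y : IsPreimage x y) (x'Rx : A.R x' x) where
    ≺y-isFilter : B.IsFilter ≺[ B.mem y ]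
    ≺y-isFilter = ≺[]-isFilter (OB.Ult-isFilter y)

    F-proper : Not ((image↑ x' ⊔ ≺[ B.mem y ]) B.⊥)
    F-proper (d , k , (a , x'∋a , fa≤d) , (b , y∋b , b≺k) , d∧k≤⊥)
      with black (A.¬ a) b (B.IsFilter.up (≺-filter b) b≺k k≤f¬a)
      where
      k≤f¬a : k B.≤ f (A.¬ a)
      k≤f¬a = OB.≤-trans (OB.x∧y≤⊥⇒x≤¬y (OB.≤-trans (OB.≤-reflexive (B.∧-comm k d)) d∧k≤⊥))
             (OB.≤-trans (OB.¬-antitone fa≤d) (OB.≤-reflexive (B.sym (hom-¬ a))))
    ... | c , b≤fc , c≺¬a = OA.Ult-consistent x' x'∋a (x'Rx (A.¬ a) (c , x∋c , c≺¬a))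
      where
      x∋c : A.mem x c
      x∋c = Equivalence.from (mem⇔ x≡y c) (B.IsFilter.up (OB.Ult-isFilter y) y∋b b≤fc)

    predecessor : Σ B.Ult λ y' → B.R y' y × IsPreimage x' y'
    predecessor with extend x' (OB.⊔-isFilter (image↑-isFilter x') ≺y-isFilter) F-proper
                        (OB.⊔-inj₁ ≺y-isFilter)
    ... | y' , F⊆y' , x'≡y' =
      y' , (λ b ≺y∋b → F⊆y' b (OB.⊔-inj₂ (image↑-isFilter x') ≺y∋b)) , x'≡y'

  ◇-transfer : (Rᴬ : A.Ult → A.Ult → Set) (Rᴮ : B.Ult → B.Ult → Set)
    {P : A.Ult → Set₁} {Q : B.Ult → Set₁} →
    (∀ {x y} → IsPreimage x y → P x ⇔ Q y) →
    (∀ {x y x' y'} → IsPreimage x y → IsPreimage x' y' → Rᴮ y y' → Rᴬ x x') →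
    (∀ {x y x'} → IsPreimage x y → Rᴬ x x' → Σ B.Ult λ y' → Rᴮ y y' × IsPreimage x' y') →
    ∀ {x y} → IsPreimage x y →
    (Σ A.Ult λ x' → Rᴬ x x' × P x') ⇔ (Σ B.Ult λ y' → Rᴮ y y' × Q y')
  ◇-transfer _ _ P⇔Q reflect lift-step x≡y = mk⇔
    (λ { (x' , r , p) → let (y' , r' , x'≡y') = lift-step x≡y r in
                        y' , r' , Equivalence.to (P⇔Q x'≡y') p })
    (λ { (y' , r' , q) → preimage y' , reflect x≡y (preimage-isPreimage y') r' ,
                         Equivalence.from (P⇔Q (preimage-isPreimage y')) q })

  ⟦⟧-preimage : ∀ {φ} → Licensed WhiteCondition BlackCondition φ → ∀ v {x y} →
    IsPreimage x y → SemA.⟦ φ ⟧ v x ⇔ SemB.⟦ φ ⟧ (f ∘ v) y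
  ⟦⟧-preimage (var n) v x≡y = mk⇔ (lift ∘ Equivalence.to   (mem⇔ x≡y (v n)) ∘ lower)
                                  (lift ∘ Equivalence.from (mem⇔ x≡y (v n)) ∘ lower)
  ⟦⟧-preimage ⊤ᶠ v x≡y = ⇔-id _
  ⟦⟧-preimage ⊥ᶠ v x≡y = ⇔-id _
  ⟦⟧-preimage (¬ᶠ φ) v x≡y = ¬-cong-⇔ (⟦⟧-preimage φ v x≡y)
  ⟦⟧-preimage (φ ∧ᶠ ψ) v x≡y = ⟦⟧-preimage φ v x≡y ×-⇔ ⟦⟧-preimage ψ v x≡y
  ⟦⟧-preimage (φ ∨ᶠ ψ) v x≡y = ⟦⟧-preimage φ v x≡y ⊎-⇔ ⟦⟧-preimage ψ v x≡y
  ⟦⟧-preimage (φ ⇒ᶠ ψ) v x≡y = →-cong-⇔ (⟦⟧-preimage φ v x≡y) (⟦⟧-preimage ψ v x≡y)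
  ⟦⟧-preimage (◇ w φ) v = ◇-transfer A.R B.R (⟦⟧-preimage φ v)
    R-reflect (WhiteLift.successor w)
  -- ⟦ □ φ ⟧ is, definitionally, ⟦ ¬ᶠ ◇ (¬ᶠ φ) ⟧, and likewise for □⁻.
  ⟦⟧-preimage (□ w φ) v = ¬-cong-⇔ ∘ ◇-transfer A.R B.R (¬-cong-⇔ ∘ ⟦⟧-preimage φ v)
    R-reflect (WhiteLift.successor w)
  ⟦⟧-preimage (◇⁻ k φ) v = ◇-transfer (flip A.R) (flip B.R) (⟦⟧-preimage φ v)
    (λ x≡y x'≡y' → R-reflect x'≡y' x≡y) (BlackLift.predecessor k)
  ⟦⟧-preimage (□⁻ k φ) v =
    ¬-cong-⇔ ∘ ◇-transfer (flip A.R) (flip B.R) (¬-cong-⇔ ∘ ⟦⟧-preimage φ v)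
    (λ x≡y x'≡y' → R-reflect x'≡y' x≡y) (BlackLift.predecessor k)

  ⊨-reflect : ∀ {φ} → Licensed WhiteCondition BlackCondition φ → S ⊨ φ → A ⊨ φ
  ⊨-reflect φ ⊨φ v x with preimage-surjective x
  ... | y , x≡y = Equivalence.from (⟦⟧-preimage φ v x≡y) (⊨φ (f ∘ v) y)

proposition2p21 : ExcludedMiddle (Level.suc 0ℓ) → UltrafilterLemma →
    ((φ : Fm) → White φ → (A B : SubordinationAlgebra) → IsSubalgebra A B →
    B ⊨ φ → A ⊨ φ)
    × ((φ : Fm) → Black φ → (A B : SubordinationAlgebra) → IsBlackSubalgebra A B →
    B ⊨ φ → A ⊨ φ)
    × ((φ : Fm) → (A B : SubordinationAlgebra) → IsStrongSubalgebra A B →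
    B ⊨ φ → A ⊨ φ)
proposition2p21 _ ul =
  (λ φ w A B s → let open IsSubalgebra s in
     Embedding.⊨-reflect ul A B emb (white-licensed white w)) ,
  (λ φ k A B s → let open IsBlackSubalgebra s in
     Embedding.⊨-reflect ul A B emb (black-licensed black k)) ,
  (λ φ A B s → let open IsStrongSubalgebra s in
     Embedding.⊨-reflect ul A B emb (all-licensed white black φ))
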